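{- For every positive integer $c$ there exists $k_0$ such that for all $k\ge k_0$, all $n\ge k^2+k$, and every family $\mathcal G\subset\binom{[n]}{k}$ with $|\mathcal G|\ge\binom{n-c}{k-c}$, there exists a subfamily $\mathcal G'\subset\mathcal G$ consisting of $k^c$ sets such that $|G_1\cap G_2|\le\log_2 k$ for all distinct $G_1,G_2\in\mathcal G'$.
   Context: $\binom{[n]}{k}$ is the family of $k$-subsets of $[n]$. -}

module Defs where

open import Data.Nat using (ℕ; _^_; _≤_)
open import Data.Fin.Subset using (Subset; ∣_∣; _∩_)
open import Data.List using (List)
open import Data.List.Relation.Unary.All using (All)
open import Data.List.Relation.Unary.Unique.Propositional using (Unique)
open import Data.List.Membership.Propositional using (_∈_)
open import Relation.Binary.PropositionalEquality using (_≡_)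
open import Relation.Nullary using (¬_)

record KFamily (n k : ℕ) : Set where
  field
    sets    : List (Subset n)
    unique  : Unique sets
    uniform : All (λ G → ∣ G ∣ ≡ k) sets

-- For a natural number m and k ≥ 1: m ≤ log₂ k  iff  2^m ≤ k.
_≤log₂_ : ℕ → ℕ → Set
m ≤log₂ k = 2 ^ m ≤ k

PairwiseSmall : {n : ℕ} → ℕ → List (Subset n) → Set
PairwiseSmall k 𝒢 = ∀ {G₁ G₂} → G₁ ∈ 𝒢 → G₂ ∈ 𝒢 → ¬ (G₁ ≡ G₂) → ∣ G₁ ∩ G₂ ∣ ≤log₂ k

-- Let 2^t ≤ k < 2^(t+1) and s = t + 1. A k-set meets at most C(k,s)·C(n−s,k−s) k-sets in s or
-- more points, so greedily picking members of 𝒢 that meet every earlier pick in at most t points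
-- cannot get stuck before k^c picks as long as k^c·C(k,s)·C(n−s,k−s) ≤ C(n−c,k−c). After
-- multiplying by s!, this follows from C(k,s)·s! ≤ k^s, from C(n−s,k−s)·k^(s−c) ≤ C(n−c,k−c)
-- (each of the s−c Pascal steps gains a factor k, as n ≥ k² + k), and from k^(2c) ≤ s!, which
-- holds once s ≥ 2L for L = c + 16^c, because then k^(2c) < 2^(2cs) ≤ L^(s−L) ≤ s!.
module Submission where

open import Defs
open import Data.Bool using (Bool; true; false)
import Data.Bool as Bool
open import Data.Empty using (⊥-elim)
open import Data.Fin.Subset using (Subset; ∣_∣; _∩_)
open import Data.Fin.Subset.Properties using (∣p∣≤n; ∩-comm; ∩-idem)
open import Data.List using (List; []; _∷_; length; filter)
open import Data.List.Membership.Propositional using (_∈_; find)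
open import Data.List.Relation.Binary.Sublist.Propositional using (_⊆_; ⊆-refl; ⊆-trans)
open import Data.List.Relation.Binary.Sublist.Propositional.Properties using (filter-⊆; length-mono-≤)
  renaming (filter⁺ to ⊆-filter⁺)
open import Data.List.Relation.Unary.All as All using (All; []; _∷_)
open import Data.List.Relation.Unary.All.Properties using (¬Any⇒All¬; ¬All⇒Any¬; all-filter)
  renaming (filter⁺ to All-filter⁺)
open import Data.List.Relation.Unary.AllPairs using ([]; _∷_)
open import Data.List.Relation.Unary.Any as Any using (Any; here; there; any?)
open import Data.List.Relation.Unary.Unique.Propositional using (Unique)
import Data.List.Relation.Unary.Unique.Propositional.Properties as Unique
open import Data.Nat
open import Data.Nat.Combinatorics using (_C_; nCk+nC[k+1]≡[n+1]C[k+1]; nCn≡1; nCk≡nC[n∸k])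
open import Data.Nat.Combinatorics.Specification using (k>n⇒nCk≡0)
open import Data.Nat.Properties
open import Data.Nat.Solver using (module +-*-Solver)
open import Data.Product using (Σ; ∃-syntax; _×_; _,_)
open import Data.Vec using (_∷_; [])
open import Function using (_∘_)
open import Relation.Binary using (Decidable)
open import Relation.Binary.PropositionalEquality
open import Relation.Nullary using (¬_; ¬?; yes; no; contradiction)
open import Relation.Nullary.Decidable using (decidable-stable)
import Relation.Unary as U

open +-*-Solver

n<2^n : ∀ n → n < 2 ^ n
n<2^n zero = s≤s z≤n
n<2^n (suc n) = begin-strict
  suc n         <⟨ +-mono-≤ (m^n>0 2 n) (n<2^n n) ⟩
  2 ^ n + 2 ^ n ≡⟨ cong (2 ^ n +_) (sym (+-identityʳ _)) ⟩
  2 ^ suc n     ∎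
  where open ≤-Reasoning

2^m<2^n⇒m<n : ∀ {m n} → 2 ^ m < 2 ^ n → m < n
2^m<2^n⇒m<n 2^m<2^n = ≰⇒> λ n≤m → <⇒≱ 2^m<2^n (^-monoʳ-≤ 2 n≤m)

binary-magnitude : ∀ k → .{{NonZero k}} → ∃[ t ] 2 ^ t ≤ k × k < 2 ^ suc t
binary-magnitude 1 = 0 , ≤-refl , s≤s (s≤s z≤n)
binary-magnitude (suc k@(suc _)) with binary-magnitude k
... | t , 2^t≤k , k<2^[1+t] with suc k <? 2 ^ suc t
...   | yes 1+k<2^[1+t] = t , m≤n⇒m≤1+n 2^t≤k , 1+k<2^[1+t]
...   | no  1+k≮2^[1+t] =
  suc t , ≤-reflexive 2^[1+t]≡1+k , subst (_< 2 ^ suc (suc t)) 2^[1+t]≡1+k (^-monoʳ-< 2 ≤-refl (n<1+n (suc t)))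
  where
  2^[1+t]≡1+k : 2 ^ suc t ≡ suc k
  2^[1+t]≡1+k = ≤-antisym (≮⇒≥ 1+k≮2^[1+t]) k<2^[1+t]

L^[n∸L]≤n! : ∀ L n → L ^ (n ∸ L) ≤ n !
L^[n∸L]≤n! L zero = ≤-reflexive (cong (L ^_) (0∸n≡0 L))
L^[n∸L]≤n! L (suc n) with suc n ≤? L
... | yes 1+n≤L = subst (λ e → L ^ e ≤ suc n !) (sym (m≤n⇒m∸n≡0 1+n≤L)) (1≤n! (suc n))
... | no  1+n≰L = begin
  L ^ (suc n ∸ L)   ≡⟨ cong (L ^_) (+-∸-assoc 1 L≤n) ⟩
  L * L ^ (n ∸ L)   ≤⟨ *-mono-≤ (m≤n⇒m≤1+n L≤n) (L^[n∸L]≤n! L n) ⟩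
  suc n * n !       ∎
  where
  open ≤-Reasoning
  L≤n : L ≤ n
  L≤n = ≤-pred (≰⇒> 1+n≰L)

^≤! : ∀ {e L s k} → 2 ^ (e + e) ≤ L → L + L ≤ s → k ≤ 2 ^ s → k ^ e ≤ s !
^≤! {e} {L} {s} {k} 4^e≤L 2L≤s k≤2^s = begin
  k ^ e                 ≤⟨ ^-monoˡ-≤ e k≤2^s ⟩
  (2 ^ s) ^ e           ≡⟨ ^-*-assoc 2 s e ⟩
  2 ^ (s * e)           ≤⟨ ^-monoʳ-≤ 2 (*-monoˡ-≤ e s≤d+d) ⟩
  2 ^ ((d + d) * e)     ≡⟨ cong (2 ^_) (solve 2 (λ d e → (d :+ d) :* e := (e :+ e) :* d) refl d e) ⟩
  2 ^ ((e + e) * d)     ≡⟨ ^-*-assoc 2 (e + e) d ⟨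
  (2 ^ (e + e)) ^ d     ≤⟨ ^-monoˡ-≤ d 4^e≤L ⟩
  L ^ d                 ≤⟨ L^[n∸L]≤n! L s ⟩
  s !                   ∎
  where
  open ≤-Reasoning
  d = s ∸ L
  L≤d : L ≤ d
  L≤d = subst (_≤ d) (m+n∸n≡m L L) (∸-monoˡ-≤ L 2L≤s)
  s≤d+d : s ≤ d + d
  s≤d+d = subst (_≤ d + d) (m∸n+n≡m (≤-trans (m≤n+m L L) 2L≤s)) (+-monoʳ-≤ d L≤d)

binomial : ℕ → ℕ → ℕ
binomial n       zero    = 1
binomial zero    (suc k) = 0
binomial (suc n) (suc k) = binomial n k + binomial n (suc k)

binomial≡C : ∀ n k → binomial n k ≡ n C k
binomial≡C n       zero    = sym (trans (nCk≡nC[n∸k] {n = n} z≤n) (nCn≡1 n))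
binomial≡C zero    (suc k) = sym (k>n⇒nCk≡0 {0} {suc k} z<s)
binomial≡C (suc n) (suc k) = trans (cong₂ _+_ (binomial≡C n k) (binomial≡C n (suc k))) (nCk+nC[k+1]≡[n+1]C[k+1] n k)

binomial-monoˡ-≤ : ∀ {m n} k → m ≤ n → binomial m k ≤ binomial n k
binomial-monoˡ-≤ zero    _         = ≤-refl
binomial-monoˡ-≤ (suc k) z≤n       = z≤n
binomial-monoˡ-≤ (suc k) (s≤s m≤n) = +-mono-≤ (binomial-monoˡ-≤ k m≤n) (binomial-monoˡ-≤ (suc k) m≤n)

binomial≡0 : ∀ {n k} → n < k → binomial n k ≡ 0
binomial≡0 {zero}  {suc k} _         = refl
binomial≡0 {suc n} {suc k} (s≤s n<k) = cong₂ _+_ (binomial≡0 n<k) (binomial≡0 (m<n⇒m<1+n n<k))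

binomial>0 : ∀ {n k} → k ≤ n → 0 < binomial n k
binomial>0 {k = zero}  _         = z<s
binomial>0 {k = suc k} (s≤s k≤n) = ≤-trans (binomial>0 k≤n) (m≤m+n _ _)

binomial-absorption : ∀ m j → binomial (suc m) (suc j) * suc j ≡ suc m * binomial m j
binomial-absorption zero    zero    = refl
binomial-absorption zero    (suc j) = refl
binomial-absorption (suc m) zero    = cong suc (binomial-absorption m zero)
binomial-absorption (suc m) (suc j) = begin
  (a + b) * (2 + j)
    ≡⟨ solve 3 (λ a b j → (a :+ b) :* (con 2 :+ j) := a :* (con 1 :+ j) :+ a :+ b :* (con 2 :+ j)) refl a b j ⟩
  a * suc j + a + b * (2 + j)
    ≡⟨ cong₂ (λ x y → x + a + y) (binomial-absorption m j) (binomial-absorption m (suc j)) ⟩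
  suc m * c + a + suc m * d
    ≡⟨ solve 3 (λ m c d → m :* c :+ (c :+ d) :+ m :* d := (con 1 :+ m) :* (c :+ d)) refl (suc m) c d ⟩
  (2 + m) * a ∎
  where
  open ≡-Reasoning
  a = binomial (suc m) (suc j)
  b = binomial (suc m) (2 + j)
  c = binomial m j
  d = binomial m (suc j)

binomial*!≤^ : ∀ n k → binomial n k * k ! ≤ n ^ k
binomial*!≤^ n       zero    = ≤-refl
binomial*!≤^ zero    (suc k) = z≤n
binomial*!≤^ (suc n) (suc k) = begin
  binomial (suc n) (suc k) * (suc k * k !) ≡⟨ *-assoc (binomial (suc n) (suc k)) (suc k) (k !) ⟨
  binomial (suc n) (suc k) * suc k * k !   ≡⟨ cong (_* k !) (binomial-absorption n k) ⟩
  suc n * binomial n k * k !               ≡⟨ *-assoc (suc n) (binomial n k) (k !) ⟩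
  suc n * (binomial n k * k !)             ≤⟨ *-monoʳ-≤ (suc n) (binomial*!≤^ n k) ⟩
  suc n * n ^ k                            ≤⟨ *-monoʳ-≤ (suc n) (^-monoˡ-≤ k (n≤1+n n)) ⟩
  suc n ^ suc k                            ∎
  where open ≤-Reasoning

binomial*k≤binomial : ∀ {m j k} → suc j ≤ k → k * k ≤ suc m → binomial m j * k ≤ binomial (suc m) (suc j)
binomial*k≤binomial {m} {j} {k@(suc _)} 1+j≤k k²≤1+m = *-cancelʳ-≤ _ _ k (begin
  binomial m j * k * k               ≡⟨ *-assoc (binomial m j) k k ⟩
  binomial m j * (k * k)             ≤⟨ *-monoʳ-≤ (binomial m j) k²≤1+m ⟩
  binomial m j * suc m               ≡⟨ *-comm (binomial m j) (suc m) ⟩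
  suc m * binomial m j               ≡⟨ binomial-absorption m j ⟨
  binomial (suc m) (suc j) * suc j   ≤⟨ *-monoʳ-≤ (binomial (suc m) (suc j)) 1+j≤k ⟩
  binomial (suc m) (suc j) * k       ∎)
  where open ≤-Reasoning

binomial*^≤binomial : ∀ d {m j k} → d + j ≤ k → k * k ≤ suc m → binomial m j * k ^ d ≤ binomial (d + m) (d + j)
binomial*^≤binomial zero    _       _       = ≤-reflexive (*-identityʳ _)
binomial*^≤binomial (suc d) {m} {j} {k} d+j<k k²≤1+m = begin
  binomial m j * (k * k ^ d)                ≡⟨ solve 3 (λ a b c → a :* (b :* c) := a :* c :* b) refl (binomial m j) k (k ^ d) ⟩
  binomial m j * k ^ d * k                  ≤⟨ *-monoˡ-≤ k (binomial*^≤binomial d (<⇒≤ d+j<k) k²≤1+m) ⟩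
  binomial (d + m) (d + j) * k              ≤⟨ binomial*k≤binomial d+j<k (≤-trans k²≤1+m (s≤s (m≤n+m m d))) ⟩
  binomial (suc d + m) (suc d + j)          ∎
  where open ≤-Reasoning

[m∸n]+[o∸m]≡o∸n : ∀ {m n o} → n ≤ m → m ≤ o → (m ∸ n) + (o ∸ m) ≡ o ∸ n
[m∸n]+[o∸m]≡o∸n {m} {n} {o} n≤m m≤o = begin
  (m ∸ n) + (o ∸ m)  ≡⟨ +-comm (m ∸ n) (o ∸ m) ⟩
  (o ∸ m) + (m ∸ n)  ≡⟨ +-∸-assoc (o ∸ m) n≤m ⟨
  (o ∸ m) + m ∸ n    ≡⟨ cong (_∸ n) (m∸n+n≡m m≤o) ⟩
  o ∸ n              ∎
  where open ≡-Reasoning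

k^c*binomial*binomial≤binomial : ∀ {c s k n} → c ≤ s → s ≤ k → k * k + k ≤ n → k ^ c * k ^ c ≤ s ! →
  k ^ c * (binomial k s * binomial (n ∸ s) (k ∸ s)) ≤ binomial (n ∸ c) (k ∸ c)
k^c*binomial*binomial≤binomial {c} {s} {k} {n} c≤s s≤k k²+k≤n K²≤s! = *-cancelʳ-≤ _ _ (s !) {{s !≢0}} (begin
  K * (X * Y) * s !    ≡⟨ solve 4 (λ K X Y F → K :* (X :* Y) :* F := K :* (X :* F) :* Y) refl K X Y (s !) ⟩
  K * (X * s !) * Y    ≤⟨ *-monoˡ-≤ Y (*-monoʳ-≤ K (binomial*!≤^ k s)) ⟩
  K * k ^ s * Y        ≡⟨ cong (λ z → K * z * Y) k^s≡K*E ⟩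
  K * (K * E) * Y      ≡⟨ solve 3 (λ K E Y → K :* (K :* E) :* Y := K :* K :* (Y :* E)) refl K E Y ⟩
  K * K * (Y * E)      ≤⟨ *-mono-≤ K²≤s! Y*E≤Z ⟩
  s ! * Z              ≡⟨ *-comm (s !) Z ⟩
  Z * s !              ∎)
  where
  open ≤-Reasoning
  K = k ^ c
  X = binomial k s
  Y = binomial (n ∸ s) (k ∸ s)
  Z = binomial (n ∸ c) (k ∸ c)
  E = k ^ (s ∸ c)
  k^s≡K*E : k ^ s ≡ K * E
  k^s≡K*E = trans (cong (k ^_) (sym (m+[n∸m]≡n c≤s))) (^-distribˡ-+-* k c (s ∸ c))
  k≤n : k ≤ n
  k≤n = ≤-trans (m≤n+m k (k * k)) k²+k≤n
  k²≤n∸s : k * k ≤ n ∸ s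
  k²≤n∸s = ≤-trans (≤-reflexive (sym (m+n∸n≡m (k * k) k))) (≤-trans (∸-monoˡ-≤ k k²+k≤n) (∸-monoʳ-≤ n s≤k))
  Y*E≤Z : Y * E ≤ Z
  Y*E≤Z = subst₂ (λ a b → Y * E ≤ binomial a b) ([m∸n]+[o∸m]≡o∸n c≤s (≤-trans s≤k k≤n)) [s∸c]+[k∸s]≡k∸c
    (binomial*^≤binomial (s ∸ c) (subst (_≤ k) (sym [s∸c]+[k∸s]≡k∸c) (m∸n≤m k c)) (m≤n⇒m≤1+n k²≤n∸s))
    where
    [s∸c]+[k∸s]≡k∸c = [m∸n]+[o∸m]≡o∸n c≤s s≤k

-- #meeting A k s is the number of k-subsets G of Fin n with s ≤ ∣ G ∩ A ∣.
#meeting : ∀ {n} → Subset n → ℕ → ℕ → ℕ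
#meeting []          zero    zero    = 1
#meeting []          zero    (suc s) = 0
#meeting []          (suc k) s       = 0
#meeting (a ∷ A)     zero    s       = #meeting A zero s
#meeting (true ∷ A)  (suc k) s       = #meeting A k (pred s) + #meeting A (suc k) s
#meeting (false ∷ A) (suc k) s       = #meeting A k s + #meeting A (suc k) s

Meets : ∀ {n} → Subset n → ℕ → ℕ → Subset n → Set
Meets A k s G = ∣ G ∣ ≡ k × s ≤ ∣ G ∩ A ∣

module _ {n : ℕ} where

  tailsWith : Bool → List (Subset (suc n)) → List (Subset n)
  tailsWith b []               = []
  tailsWith b ((b′ ∷ v) ∷ xs) with b′ Bool.≟ b
  ... | yes _ = v ∷ tailsWith b xs
  ... | no  _ = tailsWith b xs

  length-tailsWith : ∀ xs → length xs ≡ length (tailsWith true xs) + length (tailsWith false xs)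
  length-tailsWith []                  = refl
  length-tailsWith ((true  ∷ v) ∷ xs) = cong suc (length-tailsWith xs)
  length-tailsWith ((false ∷ v) ∷ xs) = trans (cong suc (length-tailsWith xs)) (sym (+-suc _ _))

  All-tailsWith : ∀ {P : Subset (suc n) → Set} b {xs} → All P xs → All (λ v → P (b ∷ v)) (tailsWith b xs)
  All-tailsWith b []                             = []
  All-tailsWith b {(b′ ∷ v) ∷ xs} (p ∷ ps) with b′ Bool.≟ b
  ... | yes refl = p ∷ All-tailsWith b ps
  ... | no  _    = All-tailsWith b ps

  Unique-tailsWith : ∀ b {xs} → Unique xs → Unique (tailsWith b xs)
  Unique-tailsWith b []                             = []
  Unique-tailsWith b {(b′ ∷ v) ∷ xs} (v∉xs ∷ u) with b′ Bool.≟ b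
  ... | yes refl =
    All.map (λ b∷v≢b∷w v≡w → b∷v≢b∷w (cong (b ∷_) v≡w)) (All-tailsWith b v∉xs) ∷ Unique-tailsWith b u
  ... | no  _    = Unique-tailsWith b u

  length≤-tailsWith : ∀ xs {t f} → length (tailsWith true xs) ≤ t → length (tailsWith false xs) ≤ f → length xs ≤ t + f
  length≤-tailsWith xs true≤t false≤f = ≤-trans (≤-reflexive (length-tailsWith xs)) (+-mono-≤ true≤t false≤f)

All-∅-length : ∀ {A : Set} {P : A → Set} {xs} → (∀ {x} → ¬ P x) → All P xs → length xs ≤ 0
All-∅-length ¬P []      = z≤n
All-∅-length ¬P (p ∷ _) = ⊥-elim (¬P p)

length≤#meeting : ∀ {n} (A : Subset n) k s {xs} → Unique xs → All (Meets A k s) xs → length xs ≤ #meeting A k s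
length≤#meeting []          zero    zero    {[]}          _                 _              = z≤n
length≤#meeting []          zero    zero    {[] ∷ []}     _                 _              = s≤s z≤n
length≤#meeting []          zero    zero    {[] ∷ [] ∷ _} ((≢[] ∷ _) ∷ _) _               = ⊥-elim (≢[] refl)
length≤#meeting []          zero    (suc s) {[]}          _                 _              = z≤n
length≤#meeting []          zero    (suc s) {[] ∷ _}      _                 ((_ , ()) ∷ _)
length≤#meeting []          (suc k) s       {[]}          _                 _              = z≤n
length≤#meeting []          (suc k) s       {[] ∷ _}      _                 ((() , _) ∷ _)
length≤#meeting (a ∷ A)     zero    s       {xs} u ms = length≤-tailsWith xs
  (All-∅-length (λ ()) (All-tailsWith true ms))
  (length≤#meeting A zero s (Unique-tailsWith false u) (All-tailsWith false ms))
length≤#meeting (true ∷ A)  (suc k) s       {xs} u ms = length≤-tailsWith xs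
  (length≤#meeting A k (pred s) (Unique-tailsWith true u)
    (All.map (λ (∣v∣≡k , s≤) → suc-injective ∣v∣≡k , pred-mono-≤ s≤) (All-tailsWith true ms)))
  (length≤#meeting A (suc k) s (Unique-tailsWith false u) (All-tailsWith false ms))
length≤#meeting (false ∷ A) (suc k) s       {xs} u ms = length≤-tailsWith xs
  (length≤#meeting A k s (Unique-tailsWith true u)
    (All.map (λ (∣v∣≡k , s≤) → suc-injective ∣v∣≡k , s≤) (All-tailsWith true ms)))
  (length≤#meeting A (suc k) s (Unique-tailsWith false u) (All-tailsWith false ms))

#meeting≡0 : ∀ {n} (A : Subset n) {k s} → k < s → #meeting A k s ≡ 0
#meeting≡0 []          {zero}  {suc s} _         = refl
#meeting≡0 []          {suc k}         _         = refl
#meeting≡0 (a ∷ A)     {zero}          k<s       = #meeting≡0 A k<s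
#meeting≡0 (true ∷ A)  {suc k} {suc s} (s≤s k<s) = cong₂ _+_ (#meeting≡0 A k<s) (#meeting≡0 A (s≤s k<s))
#meeting≡0 (false ∷ A) {suc k}         1+k<s     = cong₂ _+_ (#meeting≡0 A (<⇒≤ 1+k<s)) (#meeting≡0 A 1+k<s)

binomial-∸-pascal : ∀ {n k s} → s ≤ k → s ≤ n →
  binomial (n ∸ s) (k ∸ s) + binomial (n ∸ s) (suc k ∸ s) ≡ binomial (suc n ∸ s) (suc k ∸ s)
binomial-∸-pascal s≤k s≤n rewrite +-∸-assoc 1 s≤k | +-∸-assoc 1 s≤n = refl

#meeting≤ : ∀ {n} (A : Subset n) {k s} → s ≤ k → #meeting A k s ≤ binomial ∣ A ∣ s * binomial (n ∸ s) (k ∸ s)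
#meeting≤ []                  {zero}  {zero}  _         = ≤-refl
#meeting≤ []                  {suc k}         _         = z≤n
#meeting≤ (a ∷ A)             {zero}  {zero}  _         = #meeting≤ A z≤n
#meeting≤ {suc n} (true ∷ A)  {suc k} {zero}  _         =
  ≤-trans (+-mono-≤ (#meeting≤ A z≤n) (#meeting≤ A z≤n)) (≤-reflexive (sym (*-distribˡ-+ 1 (binomial n k) _)))
#meeting≤ {suc n} (true ∷ A)  {suc k} {suc s} (s≤s s≤k) = begin
  #meeting A k s + #meeting A (suc k) (suc s)
    ≤⟨ +-mono-≤ (#meeting≤ A s≤k) (#meeting≤ A (s≤s s≤k)) ⟩
  binomial a s * binomial (n ∸ s) (k ∸ s) + binomial a (suc s) * binomial (n ∸ suc s) (k ∸ s)
    ≤⟨ +-monoʳ-≤ _ (*-monoʳ-≤ (binomial a (suc s)) (binomial-monoˡ-≤ (k ∸ s) (∸-monoʳ-≤ n (n≤1+n s)))) ⟩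
  binomial a s * binomial (n ∸ s) (k ∸ s) + binomial a (suc s) * binomial (n ∸ s) (k ∸ s)
    ≡⟨ *-distribʳ-+ (binomial (n ∸ s) (k ∸ s)) (binomial a s) (binomial a (suc s)) ⟨
  (binomial a s + binomial a (suc s)) * binomial (n ∸ s) (k ∸ s) ∎
  where
  open ≤-Reasoning
  a = ∣ A ∣
#meeting≤ {suc n} (false ∷ A) {suc k} {s}     s≤1+k with s ≤? k
... | yes s≤k = begin
  #meeting A k s + #meeting A (suc k) s
    ≤⟨ +-mono-≤ (#meeting≤ A s≤k) (#meeting≤ A s≤1+k) ⟩
  binomial a s * binomial (n ∸ s) (k ∸ s) + binomial a s * binomial (n ∸ s) (suc k ∸ s)
    ≡⟨ *-distribˡ-+ (binomial a s) _ _ ⟨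
  binomial a s * (binomial (n ∸ s) (k ∸ s) + binomial (n ∸ s) (suc k ∸ s))
    ≤⟨ pascal ⟩
  binomial a s * binomial (suc n ∸ s) (suc k ∸ s) ∎
  where
  open ≤-Reasoning
  a = ∣ A ∣
  pascal : binomial a s * (binomial (n ∸ s) (k ∸ s) + binomial (n ∸ s) (suc k ∸ s))
         ≤ binomial a s * binomial (suc n ∸ s) (suc k ∸ s)
  pascal with s ≤? n
  ... | yes s≤n = ≤-reflexive (cong (binomial a s *_) (binomial-∸-pascal s≤k s≤n))
  ... | no  s≰n rewrite binomial≡0 (≤-<-trans (∣p∣≤n A) (≰⇒> s≰n)) = z≤n
... | no  s≰k = begin
  #meeting A k s + #meeting A (suc k) s       ≡⟨ cong (_+ #meeting A (suc k) s) (#meeting≡0 A (≰⇒> s≰k)) ⟩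
  #meeting A (suc k) s                        ≤⟨ #meeting≤ A s≤1+k ⟩
  binomial a s * binomial (n ∸ s) (suc k ∸ s) ≡⟨ cong (binomial a s *_) bottom-irrelevant ⟩
  binomial a s * binomial (suc n ∸ s) (suc k ∸ s) ∎
  where
  open ≤-Reasoning
  a = ∣ A ∣
  bottom-irrelevant : binomial (n ∸ s) (suc k ∸ s) ≡ binomial (suc n ∸ s) (suc k ∸ s)
  bottom-irrelevant rewrite m≤n⇒m∸n≡0 (≰⇒> s≰k) = refl

length-filter-∁ : ∀ {A : Set} {P : A → Set} (P? : U.Decidable P) xs →
  length xs ≡ length (filter P? xs) + length (filter (¬? ∘ P?) xs)
length-filter-∁ P? []       = refl
length-filter-∁ P? (x ∷ xs) with P? x
... | yes _ = cong suc (length-filter-∁ P? xs)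
... | no  _ = trans (cong suc (length-filter-∁ P? xs)) (sym (+-suc _ _))

m<n∧n*o≤p⇒m*o<p : ∀ {m n o p} → m < n → n * o ≤ p → 0 < p → m * o < p
m<n∧n*o≤p⇒m*o<p {m} {o = zero} {p} _ _ 0<p = subst (_< p) (sym (*-zeroʳ m)) 0<p
m<n∧n*o≤p⇒m*o<p     {o = suc o} m<n n*o≤p _   = <-≤-trans (*-monoˡ-< (suc o) m<n) n*o≤p

module IndependentSublist {A : Set} {R : A → A → Set} (R? : Decidable R) (xs : List A) where

  conflicts? : ∀ H → U.Decidable (λ G → R G H)
  conflicts? H G = R? G H

  degree : A → ℕ
  degree H = length (filter (conflicts? H) xs)

  Independent : List A → Set
  Independent P = ∀ {G H} → G ∈ P → H ∈ P → G ≢ H → ¬ R G H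

  length≤-covered : ∀ {B} P {ys} → ys ⊆ xs → All (λ H → degree H ≤ B) P →
    All (λ y → Any (R y) P) ys → length ys ≤ length P * B
  length≤-covered []            {[]}    _      _              _            = z≤n
  length≤-covered []            {_ ∷ _} _      _              (() ∷ _)
  length≤-covered {B} (H ∷ P) {ys}    ys⊆xs (degH≤B ∷ deg≤B) covered = begin
    length ys
      ≡⟨ length-filter-∁ (conflicts? H) ys ⟩
    length (filter (conflicts? H) ys) + length (filter (¬? ∘ conflicts? H) ys)
      ≤⟨ +-mono-≤ (≤-trans (length-mono-≤ (⊆-filter⁺ (conflicts? H) (conflicts? H) (λ { refl r → r }) ys⊆xs)) degH≤B)
                  (length≤-covered P (⊆-trans (filter-⊆ (¬? ∘ conflicts? H) ys) ys⊆xs) deg≤B covered-by-P) ⟩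
    B + length P * B ∎
    where
    open ≤-Reasoning
    covered-by-P : All (λ y → Any (R y) P) (filter (¬? ∘ conflicts? H) ys)
    covered-by-P = All.zipWith (λ (by-H∷P , ¬byH) → Any.tail ¬byH by-H∷P)
      (All-filter⁺ (¬? ∘ conflicts? H) covered , all-filter (¬? ∘ conflicts? H) ys)

  module _ {B : ℕ} (degree≤ : ∀ {H} → H ∈ xs → degree H ≤ B)
           (R-refl : ∀ {G} → G ∈ xs → R G G) (R-sym : ∀ {G H} → R G H → R H G) where

    avoider : ∀ {P} → All (_∈ xs) P → length P * B < length xs → ∃[ x ] x ∈ xs × All (λ H → ¬ R x H) P
    avoider {P} P⊆xs small with any? (λ x → All.all? (λ H → ¬? (R? x H)) P) xs
    ... | yes found = find found
    ... | no  none  = contradiction (length≤-covered P ⊆-refl (All.map degree≤ P⊆xs) covered) (<⇒≱ small)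
      where
      covered : All (λ y → Any (R y) P) xs
      covered = All.map (λ {y} ¬avoids → Any.map (decidable-stable (R? y _)) (¬All⇒Any¬ (λ H → ¬? (R? y H)) P ¬avoids))
                        (¬Any⇒All¬ xs none)

    Independent-∷ : ∀ {x P} → All (λ H → ¬ R x H) P → Independent P → Independent (x ∷ P)
    Independent-∷ x-avoids indep (here refl) (here refl) x≢x = contradiction refl x≢x
    Independent-∷ x-avoids indep (here refl) (there h)   _   = All.lookup x-avoids h
    Independent-∷ x-avoids indep (there g)   (here refl) _   = All.lookup x-avoids g ∘ R-sym
    Independent-∷ x-avoids indep (there g)   (there h)       = indep g h

    independent-sublist : ∀ {K} → K * B ≤ length xs → 0 < length xs →
      Σ (List A) λ P → Unique P × All (_∈ xs) P × length P ≡ K × Independent P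
    independent-sublist {K} K*B≤∣xs∣ 0<∣xs∣ = grow K ≤-refl
      where
      grow : ∀ m → m ≤ K → Σ (List A) λ P → Unique P × All (_∈ xs) P × length P ≡ m × Independent P
      grow zero    _   = [] , [] , [] , refl , λ ()
      grow (suc m) m<K with grow m (<⇒≤ m<K)
      ... | P , unique , P⊆xs , ∣P∣≡m , indep
        with avoider P⊆xs (subst (λ l → l * B < length xs) (sym ∣P∣≡m) (m<n∧n*o≤p⇒m*o<p m<K K*B≤∣xs∣ 0<∣xs∣))
      ... | x , x∈xs , x-avoids =
        x ∷ P , All.map (λ ¬Rxh x≡h → ¬Rxh (subst (R x) x≡h (R-refl x∈xs))) x-avoids ∷ unique ,
        x∈xs ∷ P⊆xs , cong suc ∣P∣≡m , Independent-∷ x-avoids indep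

spread-subfamily : ∀ {n k s K} (𝒢 : KFamily n k) → s ≤ k →
  K * (binomial k s * binomial (n ∸ s) (k ∸ s)) ≤ length (KFamily.sets 𝒢) → 0 < length (KFamily.sets 𝒢) →
  Σ (List (Subset n)) λ 𝒢′ → Unique 𝒢′ × All (_∈ KFamily.sets 𝒢) 𝒢′ × length 𝒢′ ≡ K ×
    (∀ {G H} → G ∈ 𝒢′ → H ∈ 𝒢′ → G ≢ H → ∣ G ∩ H ∣ < s)
spread-subfamily {n} {k} {s} 𝒢 s≤k large nonempty =
  let 𝒢′ , unique′ , 𝒢′⊆𝒢 , ∣𝒢′∣≡K , independent =
        independent-sublist degree≤ meets-itself (λ {G} {H} → meets-sym {G} {H}) large nonempty
  in  𝒢′ , unique′ , 𝒢′⊆𝒢 , ∣𝒢′∣≡K , λ g h g≢h → ≰⇒> (independent g h g≢h)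
  where
  open KFamily 𝒢
  open IndependentSublist (λ G H → s ≤? ∣ G ∩ H ∣) sets
  degree≤ : ∀ {H} → H ∈ sets → degree H ≤ binomial k s * binomial (n ∸ s) (k ∸ s)
  degree≤ {H} H∈sets = begin
    degree H
      ≤⟨ length≤#meeting H k s (Unique.filter⁺ (conflicts? H) unique)
           (All.zip (All-filter⁺ (conflicts? H) uniform , all-filter (conflicts? H) sets)) ⟩
    #meeting H k s
      ≤⟨ #meeting≤ H s≤k ⟩
    binomial ∣ H ∣ s * binomial (n ∸ s) (k ∸ s)
      ≡⟨ cong (λ h → binomial h s * binomial (n ∸ s) (k ∸ s)) (All.lookup uniform H∈sets) ⟩
    binomial k s * binomial (n ∸ s) (k ∸ s) ∎
    where open ≤-Reasoning
  meets-itself : ∀ {G} → G ∈ sets → s ≤ ∣ G ∩ G ∣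
  meets-itself {G} G∈sets = subst (s ≤_) (sym (trans (cong ∣_∣ (∩-idem G)) (All.lookup uniform G∈sets))) s≤k
  meets-sym : ∀ {G H} → s ≤ ∣ G ∩ H ∣ → s ≤ ∣ H ∩ G ∣
  meets-sym {G} {H} = subst (s ≤_) (cong ∣_∣ (∩-comm G H))

spread-subfamily-at-scale : ∀ {c L t k n} (𝒢 : KFamily n k) → 2 ^ ((c + c) + (c + c)) ≤ L → c ≤ L →
  L + L ≤ suc t → 2 ^ t ≤ k → k < 2 ^ suc t → k * k + k ≤ n → (n ∸ c) C (k ∸ c) ≤ length (KFamily.sets 𝒢) →
  Σ (List (Subset n)) λ 𝒢′ →
    Unique 𝒢′ × All (_∈ KFamily.sets 𝒢) 𝒢′ × length 𝒢′ ≡ k ^ c × PairwiseSmall k 𝒢′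
spread-subfamily-at-scale {c} {L} {t} {k} {n} 𝒢 16^c≤L c≤L 2L≤s 2^t≤k k<2^s k²+k≤n C≤∣𝒢∣ =
  let 𝒢′ , unique′ , 𝒢′⊆𝒢 , ∣𝒢′∣≡K , spread =
        spread-subfamily 𝒢 s≤k (≤-trans K*B≤Z Z≤∣𝒢∣) (<-≤-trans 0<Z Z≤∣𝒢∣)
  in  𝒢′ , unique′ , 𝒢′⊆𝒢 , ∣𝒢′∣≡K , λ g h g≢h → ≤-trans (^-monoʳ-≤ 2 (≤-pred (spread g h g≢h))) 2^t≤k
  where
  s = suc t
  s≤k : s ≤ k
  s≤k = ≤-trans (n<2^n t) 2^t≤k
  K*B≤Z : k ^ c * (binomial k s * binomial (n ∸ s) (k ∸ s)) ≤ binomial (n ∸ c) (k ∸ c)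
  K*B≤Z = k^c*binomial*binomial≤binomial (≤-trans c≤L (≤-trans (m≤m+n L L) 2L≤s)) s≤k k²+k≤n
    (subst (_≤ s !) (^-distribˡ-+-* k c c) (^≤! {c + c} 16^c≤L 2L≤s (<⇒≤ k<2^s)))
  Z≤∣𝒢∣ : binomial (n ∸ c) (k ∸ c) ≤ length (KFamily.sets 𝒢)
  Z≤∣𝒢∣ = subst (_≤ length (KFamily.sets 𝒢)) (sym (binomial≡C (n ∸ c) (k ∸ c))) C≤∣𝒢∣
  0<Z : 0 < binomial (n ∸ c) (k ∸ c)
  0<Z = binomial>0 (∸-monoˡ-≤ c (≤-trans (m≤n+m k (k * k)) k²+k≤n))

lemma4 : (c : ℕ) → .{{_ : NonZero c}} →
  ∃[ k₀ ] ((k n : ℕ) → k ≥ k₀ → c ≤ k → n ≥ k * k + k →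
    (𝒢 : KFamily n k) →
    length (KFamily.sets 𝒢) ≥ (n ∸ c) C (k ∸ c) →
    Σ (List (Subset n)) λ 𝒢′ →
      Unique 𝒢′ × All (λ G → G ∈ KFamily.sets 𝒢) 𝒢′ ×
      length 𝒢′ ≡ k ^ c × PairwiseSmall k 𝒢′)
lemma4 c = 2 ^ (L + L) , λ k n 2^2L≤k _ k²+k≤n 𝒢 ∣𝒢∣≥ →
    let t , 2^t≤k , k<2^[1+t] = binary-magnitude k {{>-nonZero (≤-trans (m^n>0 2 (L + L)) 2^2L≤k)}}
    in  spread-subfamily-at-scale {t = t} 𝒢 (m≤n+m _ c) (m≤m+n c _) (<⇒≤ (2^m<2^n⇒m<n (≤-<-trans 2^2L≤k k<2^[1+t])))
          2^t≤k k<2^[1+t] k²+k≤n ∣𝒢∣≥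
  where
  L : ℕ
  L = c + 2 ^ ((c + c) + (c + c))
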